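{- Let $G$ be a connected graph of order $n\ge 4$, and let $\tau'(G)$ denote the smallest number $k$ such that there is a proper edge coloring $f\colon E(G)\to\{1,\dots,k\}$ that distinguishes triangles. Then $\tau'(G)\le n$ if $n$ is odd, and $\tau'(G)\le n+1$ if $n$ is even.
   Context: For an edge coloring $f\colon E\to\{1,\dots,k\}$ of a graph $G=(V,E)$ and a triangle $T\subseteq G$ (a subgraph isomorphic to $K_3$), the palette of $T$ is $F(T)=\{f(e): e\in E(T)\}$. The coloring $f$ distinguishes triangles if $F(T_1)\neq F(T_2)$ for every two different triangles $T_1,T_2$ of $G$. An edge coloring is proper if adjacent edges receive distinct colors. -}

module Defs where

open import Data.Nat using (ℕ; suc; _+_)
open import Data.Nat.Properties using ()
open import Data.Fin using (Fin; _<_)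
open import Data.Product using (Σ; _×_; _,_)
open import Data.Sum using (_⊎_)
open import Data.Bool using (Bool; true; false; T)
open import Relation.Binary.PropositionalEquality using (_≡_; _≢_)
open import Relation.Nullary using (¬_)

-- Adjacency is Bool-valued so that proofs of adjacency are unique
-- (colours cannot depend on the choice of adjacency proof).
record Graph (n : ℕ) : Set where
  field
    adj    : Fin n → Fin n → Bool
    adj-sym : ∀ u v → adj u v ≡ adj v u
    adj-irrefl : ∀ u → adj u u ≡ false

open Graph public

Adj : ∀ {n} → Graph n → Fin n → Fin n → Set
Adj G u v = T (adj G u v)

sym : ∀ {n} (G : Graph n) {u v : Fin n} → Adj G u v → Adj G v u
sym G {u} {v} e rewrite adj-sym G u v = e

data Reach {n : ℕ} (G : Graph n) : Fin n → Fin n → Set where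
  here : ∀ {u} → Reach G u u
  step : ∀ {u v w} → Adj G u v → Reach G v w → Reach G u w

Connected : ∀ {n} → Graph n → Set
Connected G = ∀ u v → Reach G u v

record EdgeColoring {n : ℕ} (G : Graph n) (k : ℕ) : Set where
  field
    col     : ∀ u v → Adj G u v → Fin k
    col-sym : ∀ u v (e : Adj G u v) → col u v e ≡ col v u (sym G e)

open EdgeColoring public

Proper : ∀ {n k} {G : Graph n} → EdgeColoring G k → Set
Proper {G = G} f =
  ∀ u v w (e₁ : Adj G u v) (e₂ : Adj G u w) → v ≢ w → col f u v e₁ ≢ col f u w e₂

-- A triangle, represented uniquely by its vertices a < b < c, pairwise adjacent.
record Triangle {n : ℕ} (G : Graph n) : Set where
  constructor tri
  field
    a b c : Fin n
    a<b   : a < b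
    b<c   : b < c
    ab    : Adj G a b
    bc    : Adj G b c
    ac    : Adj G a c

open Triangle public

SameTriangle : ∀ {n} {G : Graph n} → Triangle G → Triangle G → Set
SameTriangle T₁ T₂ = (a T₁ ≡ a T₂) × (b T₁ ≡ b T₂) × (c T₁ ≡ c T₂)

InPalette : ∀ {n k} {G : Graph n} → EdgeColoring G k → Triangle G → Fin k → Set
InPalette f T x =
  (x ≡ col f (a T) (b T) (ab T)) ⊎ (x ≡ col f (b T) (c T) (bc T)) ⊎ (x ≡ col f (a T) (c T) (ac T))

SamePalette : ∀ {n k} {G : Graph n} → EdgeColoring G k → Triangle G → Triangle G → Set
SamePalette f T₁ T₂ = ∀ x → (InPalette f T₁ x → InPalette f T₂ x) × (InPalette f T₂ x → InPalette f T₁ x)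

DistinguishesTriangles : ∀ {n k} {G : Graph n} → EdgeColoring G k → Set
DistinguishesTriangles f = ∀ T₁ T₂ → ¬ SameTriangle T₁ T₂ → ¬ SamePalette f T₁ T₂

τ′≤ : ∀ {n} → Graph n → ℕ → Set
τ′≤ G k = Σ (EdgeColoring G k) λ f → Proper f × DistinguishesTriangles f

{-# OPTIONS --safe #-}
-- Colour the edge uv by (u + v) mod m for an odd m ≥ n (m = n or m = n + 1). Since
-- u + v ≡ u + w forces v = w, the colouring is proper, so a triangle abc receives the three
-- distinct colours a + b, b + c, a + c. Their sum is 2(a + b + c) and 2 is invertible modulo
-- the odd m, so the palette determines σ = a + b + c; every vertex is σ minus the colour of
-- the opposite edge, so the palette determines the vertex set of the triangle.
module Submission where

open import Defs
open import Data.Nat using (ℕ; _≤_; _+_; _%_)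
open import Data.Product using (_×_)
open import Relation.Binary.PropositionalEquality using (_≡_)

open import Data.Nat.Base using (zero; suc; _*_; _/_; _<_; NonZero)
open import Data.Nat.Properties using (+-comm; ≤-refl; m≤m+n; <-≤-trans; <⇒≤)
open import Data.Nat.DivMod
  using (_mod_; m≡m%n+[m/n]*n; m%n%n≡m%n; [m+kn]%n≡m%n; m<n⇒m%n≡m; %-distribˡ-+; %-distribˡ-*)
open import Data.Nat.ListAction using (sum)
open import Data.Nat.ListAction.Properties using (sum-↭)
open import Data.Nat.Tactic.RingSolver using (solve-∀)
open import Data.Fin.Base using (Fin; toℕ)
open import Data.Fin.Properties using (toℕ-injective; toℕ<n; toℕ-fromℕ<; <⇒≢; ≤-totalOrder)
import Data.Fin.Properties as Fin
open import Data.List.Base using (List; []; _∷_; map)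
open import Data.List.Membership.Propositional using (_∈_)
open import Data.List.Membership.Propositional.Properties.WithK using (unique∧set⇒bag)
open import Data.List.Relation.Unary.Any using (here; there)
open import Data.List.Relation.Unary.All using ([]; _∷_)
open import Data.List.Relation.Unary.AllPairs using ([]; _∷_)
open import Data.List.Relation.Unary.Unique.Propositional using (Unique)
open import Data.List.Relation.Unary.Linked using ([-]; _∷_)
open import Data.List.Relation.Unary.Sorted.TotalOrder using (Sorted)
open import Data.List.Relation.Unary.Sorted.TotalOrder.Properties using (↗↭↗⇒≋)
open import Data.List.Relation.Binary.Pointwise using ([]; _∷_)
open import Data.List.Relation.Binary.BagAndSetEquality using (∼bag⇒↭)
open import Data.List.Relation.Binary.Permutation.Propositional using (_↭_; ↭⇒↭ₛ′)
open import Data.List.Relation.Binary.Permutation.Propositional.Properties using (map⁺)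
open import Data.Product using (_,_; proj₁; swap; ∃-syntax)
open import Function.Base using (_∘_)
open import Data.Sum using (inj₁; inj₂)
open import Function.Bundles using (mk⇔)
open import Relation.Binary.Bundles using (TotalOrder)
open import Relation.Binary.PropositionalEquality using (_≢_; refl; cong; cong₂; trans; subst; ≢-sym; module ≡-Reasoning)
  renaming (sym to ≡-sym)

module _ {d : ℕ} .{{_ : NonZero d}} where
  open ≡-Reasoning

  m%d≡n%d⇒[m+o]%d≡[n+o]%d : ∀ m n o → m % d ≡ n % d → (m + o) % d ≡ (n + o) % d
  m%d≡n%d⇒[m+o]%d≡[n+o]%d m n o eq = begin
    (m + o) % d               ≡⟨ %-distribˡ-+ m o d ⟩
    (m % d + o % d) % d       ≡⟨ cong (λ r → (r + o % d) % d) eq ⟩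
    (n % d + o % d) % d       ≡⟨ %-distribˡ-+ n o d ⟨
    (n + o) % d               ∎

  m%d≡n%d⇒[o*m]%d≡[o*n]%d : ∀ m n o → m % d ≡ n % d → (o * m) % d ≡ (o * n) % d
  m%d≡n%d⇒[o*m]%d≡[o*n]%d m n o eq = begin
    (o * m) % d               ≡⟨ %-distribˡ-* o m d ⟩
    (o % d * (m % d)) % d     ≡⟨ cong (λ r → (o % d * r) % d) eq ⟩
    (o % d * (n % d)) % d     ≡⟨ %-distribˡ-* o n d ⟨
    (o * n) % d               ∎

  [m+n%d]%d≡[m+n]%d : ∀ m n → (m + n % d) % d ≡ (m + n) % d
  [m+n%d]%d≡[m+n]%d m n = begin
    (m + n % d) % d           ≡⟨ %-distribˡ-+ m (n % d) d ⟩
    (m % d + n % d % d) % d   ≡⟨ cong (λ r → (m % d + r) % d) (m%n%n≡m%n n d) ⟩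
    (m % d + n % d) % d       ≡⟨ %-distribˡ-+ m n d ⟨
    (m + n) % d               ∎

  sum-map-% : ∀ xs → sum (map (_% d) xs) % d ≡ sum xs % d
  sum-map-% []       = refl
  sum-map-% (x ∷ xs) = begin
    (x % d + sum (map (_% d) xs)) % d  ≡⟨ m%d≡n%d⇒[m+o]%d≡[n+o]%d (x % d) x _ (m%n%n≡m%n x d) ⟩
    (x + sum (map (_% d) xs)) % d      ≡⟨ [m+n%d]%d≡[m+n]%d x _ ⟨
    (x + sum (map (_% d) xs) % d) % d  ≡⟨ cong (λ r → (x + r) % d) (sum-map-% xs) ⟩
    (x + sum xs % d) % d               ≡⟨ [m+n%d]%d≡[m+n]%d x (sum xs) ⟩
    (x + sum xs) % d                   ∎

  m<d⇒n<d⇒m%d≡n%d⇒m≡n : ∀ {m n} → m < d → n < d → m % d ≡ n % d → m ≡ n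
  m<d⇒n<d⇒m%d≡n%d⇒m≡n m<d n<d eq = trans (≡-sym (m<n⇒m%n≡m m<d)) (trans eq (m<n⇒m%n≡m n<d))

-- Adding m * (d ∸ 1), which is −m modulo d, undoes the addition of m.
[m+n]%d≡[m+o]%d⇒n%d≡o%d : ∀ m n o d .{{_ : NonZero d}} → (m + n) % d ≡ (m + o) % d → n % d ≡ o % d
[m+n]%d≡[m+o]%d⇒n%d≡o%d m n o d@(suc d-1) eq = begin
  n % d                     ≡⟨ [m+kn]%n≡m%n n m d ⟨
  (n + m * d) % d           ≡⟨ cong (_% d) (shift n m d-1) ⟩
  (m + n + m * d-1) % d     ≡⟨ m%d≡n%d⇒[m+o]%d≡[n+o]%d (m + n) (m + o) (m * d-1) eq ⟩
  (m + o + m * d-1) % d     ≡⟨ cong (_% d) (shift o m d-1) ⟨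
  (o + m * d) % d           ≡⟨ [m+kn]%n≡m%n o m d ⟩
  o % d                     ∎
  where
  open ≡-Reasoning
  shift : ∀ x y k → x + y * suc k ≡ y + x + y * k
  shift = solve-∀

-- For odd d, suc (d / 2) is the inverse of 2 modulo d.
[m+m]%d≡[n+n]%d⇒m%d≡n%d : ∀ {m n d} .{{_ : NonZero d}} → d % 2 ≡ 1 →
  (m + m) % d ≡ (n + n) % d → m % d ≡ n % d
[m+m]%d≡[n+n]%d⇒m%d≡n%d {m} {n} {d} odd eq = begin
  m % d                     ≡⟨ [m+kn]%n≡m%n m m d ⟨
  (m + m * d) % d           ≡⟨ cong (_% d) (halve m) ⟩
  (h * (m + m)) % d         ≡⟨ m%d≡n%d⇒[o*m]%d≡[o*n]%d (m + m) (n + n) h eq ⟩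
  (h * (n + n)) % d         ≡⟨ cong (_% d) (halve n) ⟨
  (n + n * d) % d           ≡⟨ [m+kn]%n≡m%n n n d ⟩
  n % d                     ∎
  where
  open ≡-Reasoning
  h : ℕ
  h = suc (d / 2)
  d≡1+[d/2]*2 : d ≡ suc (d / 2 * 2)
  d≡1+[d/2]*2 = trans (m≡m%n+[m/n]*n d 2) (cong (_+ d / 2 * 2) odd)
  halve : ∀ x → x + x * d ≡ h * (x + x)
  halve x = trans (cong (λ e → x + x * e) d≡1+[d/2]*2) (identity x (d / 2))
    where
    identity : ∀ x k → x + x * suc (k * 2) ≡ suc k * (x + x)
    identity = solve-∀

unique∧⊆∧⊇⇒↭ : ∀ {A : Set} {xs ys : List A} → Unique xs → Unique ys →
  (∀ {x} → x ∈ xs → x ∈ ys) → (∀ {x} → x ∈ ys → x ∈ xs) → xs ↭ ys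
unique∧⊆∧⊇⇒↭ xs! ys! xs⊆ys ys⊆xs = ∼bag⇒↭ (unique∧set⇒bag xs! ys! (mk⇔ xs⊆ys ys⊆xs))

module _ {n : ℕ} {G : Graph n} where

  vertices : Triangle G → List (Fin n)
  vertices T = a T ∷ b T ∷ c T ∷ []

  vertices-unique : (T : Triangle G) → Unique (vertices T)
  vertices-unique T = (<⇒≢ (a<b T) ∷ <⇒≢ a<c ∷ []) ∷ (<⇒≢ (b<c T) ∷ []) ∷ [] ∷ []
    where a<c = Fin.<-trans (a<b T) (b<c T)

  vertices-sorted : (T : Triangle G) → Sorted (≤-totalOrder n) (vertices T)
  vertices-sorted T = <⇒≤ (a<b T) ∷ <⇒≤ (b<c T) ∷ [-]

  same-vertices⇒SameTriangle : ∀ {T₁ T₂ : Triangle G} →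
    (∀ {v} → v ∈ vertices T₁ → v ∈ vertices T₂) → (∀ {v} → v ∈ vertices T₂ → v ∈ vertices T₁) →
    SameTriangle T₁ T₂
  same-vertices⇒SameTriangle {T₁} {T₂} ⊆₁ ⊆₂
    with ↗↭↗⇒≋ (≤-totalOrder n) (vertices-sorted T₁) (vertices-sorted T₂)
           (↭⇒↭ₛ′ (TotalOrder.isEquivalence (≤-totalOrder n))
             (unique∧⊆∧⊇⇒↭ (vertices-unique T₁) (vertices-unique T₂) ⊆₁ ⊆₂))
  ... | a≡ ∷ b≡ ∷ c≡ ∷ [] = a≡ , b≡ , c≡

  module _ {k : ℕ} (f : EdgeColoring G k) where

    palette : Triangle G → List (Fin k)
    palette T = col f (a T) (b T) (ab T) ∷ col f (b T) (c T) (bc T) ∷ col f (a T) (c T) (ac T) ∷ []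

    ∈palette⇒InPalette : ∀ T {x} → x ∈ palette T → InPalette f T x
    ∈palette⇒InPalette _ (here e)                 = inj₁ e
    ∈palette⇒InPalette _ (there (here e))         = inj₂ (inj₁ e)
    ∈palette⇒InPalette _ (there (there (here e))) = inj₂ (inj₂ e)

    InPalette⇒∈palette : ∀ T {x} → InPalette f T x → x ∈ palette T
    InPalette⇒∈palette _ (inj₁ e)        = here e
    InPalette⇒∈palette _ (inj₂ (inj₁ e)) = there (here e)
    InPalette⇒∈palette _ (inj₂ (inj₂ e)) = there (there (here e))

    palette-unique : Proper f → (T : Triangle G) → Unique (palette T)
    palette-unique proper T =
      (ab≢bc ∷ proper (a T) (b T) (c T) (ab T) (ac T) (<⇒≢ (b<c T)) ∷ []) ∷ (bc≢ac ∷ []) ∷ [] ∷ []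
      where
      ab≢bc : col f (a T) (b T) (ab T) ≢ col f (b T) (c T) (bc T)
      ab≢bc eq = proper (b T) (a T) (c T) (sym G (ab T)) (bc T) (<⇒≢ (Fin.<-trans (a<b T) (b<c T)))
        (trans (≡-sym (col-sym f (a T) (b T) (ab T))) eq)
      bc≢ac : col f (b T) (c T) (bc T) ≢ col f (a T) (c T) (ac T)
      bc≢ac eq = proper (c T) (b T) (a T) (sym G (bc T)) (sym G (ac T)) (≢-sym (<⇒≢ (a<b T)))
        (trans (≡-sym (col-sym f (b T) (c T) (bc T))) (trans eq (col-sym f (a T) (c T) (ac T))))

    SamePalette-sym : ∀ {T₁ T₂} → SamePalette f T₁ T₂ → SamePalette f T₂ T₁
    SamePalette-sym same x = swap (same x)

    SamePalette⇒palette-⊆ : ∀ {T₁ T₂} → SamePalette f T₁ T₂ → ∀ {x} → x ∈ palette T₁ → x ∈ palette T₂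
    SamePalette⇒palette-⊆ {T₁} {T₂} same {x} =
      InPalette⇒∈palette T₂ ∘ proj₁ (same x) ∘ ∈palette⇒InPalette T₁

    SamePalette⇒palette-↭ : Proper f → ∀ {T₁ T₂} → SamePalette f T₁ T₂ → palette T₁ ↭ palette T₂
    SamePalette⇒palette-↭ proper {T₁} {T₂} same =
      unique∧⊆∧⊇⇒↭ (palette-unique proper T₁) (palette-unique proper T₂)
        (SamePalette⇒palette-⊆ {T₁} {T₂} same)
        (SamePalette⇒palette-⊆ {T₂} {T₁} (SamePalette-sym {T₁} {T₂} same))

module SumColouring {n : ℕ} (G : Graph n) (m : ℕ) .{{_ : NonZero m}} (n≤m : n ≤ m) where
  open ≡-Reasoning

  colour : Fin n → Fin n → Fin m
  colour u v = (toℕ u + toℕ v) mod m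

  toℕ-colour : ∀ u v → toℕ (colour u v) ≡ (toℕ u + toℕ v) % m
  toℕ-colour u v = toℕ-fromℕ< _

  colouring : EdgeColoring G m
  colouring = record
    { col     = λ u v _ → colour u v
    ; col-sym = λ u v _ → cong (_mod m) (+-comm (toℕ u) (toℕ v))
    }

  [x+v]%m-injective : ∀ x {v w : Fin n} → (x + toℕ v) % m ≡ (x + toℕ w) % m → v ≡ w
  [x+v]%m-injective x {v} {w} eq =
    toℕ-injective (m<d⇒n<d⇒m%d≡n%d⇒m≡n (bound v) (bound w)
      ([m+n]%d≡[m+o]%d⇒n%d≡o%d x _ _ m eq))
    where
    bound : (v : Fin n) → toℕ v < m
    bound v = <-≤-trans (toℕ<n v) n≤m

  proper : Proper colouring
  proper u v w _ _ v≢w eq = v≢w ([x+v]%m-injective (toℕ u) (begin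
    (toℕ u + toℕ v) % m  ≡⟨ toℕ-colour u v ⟨
    toℕ (colour u v)     ≡⟨ cong toℕ eq ⟩
    toℕ (colour u w)     ≡⟨ toℕ-colour u w ⟩
    (toℕ u + toℕ w) % m  ∎))

  σ : Triangle G → ℕ
  σ T = toℕ (a T) + toℕ (b T) + toℕ (c T)

  -- For the sum colouring this says that x is the colour of the edge of T opposite to v.
  Opposite : Triangle G → Fin n → Fin m → Set
  Opposite T v x = (toℕ x + toℕ v) % m ≡ σ T % m

  opposite : ∀ T u v w → toℕ v + toℕ w + toℕ u ≡ σ T → Opposite T u (colour v w)
  opposite T u v w eq = begin
    (toℕ (colour v w) + toℕ u) % m        ≡⟨ cong (λ r → (r + toℕ u) % m) (toℕ-colour v w) ⟩
    ((toℕ v + toℕ w) % m + toℕ u) % m     ≡⟨ m%d≡n%d⇒[m+o]%d≡[n+o]%d _ _ (toℕ u) (m%n%n≡m%n _ m) ⟩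
    (toℕ v + toℕ w + toℕ u) % m           ≡⟨ cong (_% m) eq ⟩
    σ T % m                               ∎

  private
    rotate : ∀ x y z → y + z + x ≡ x + y + z
    rotate = solve-∀

    exchange : ∀ x y z → x + z + y ≡ x + y + z
    exchange = solve-∀

  vertex⇒opposite-colour : ∀ T {v} → v ∈ vertices T →
    ∃[ x ] x ∈ palette colouring T × Opposite T v x
  vertex⇒opposite-colour T (here refl) =
    colour (b T) (c T) , there (here refl) , opposite T (a T) (b T) (c T) (rotate (toℕ (a T)) _ _)
  vertex⇒opposite-colour T (there (here refl)) =
    colour (a T) (c T) , there (there (here refl)) ,
    opposite T (b T) (a T) (c T) (exchange (toℕ (a T)) _ _)
  vertex⇒opposite-colour T (there (there (here refl))) =
    colour (a T) (b T) , here refl , opposite T (c T) (a T) (b T) refl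

  colour⇒opposite-vertex : ∀ T {x} → x ∈ palette colouring T →
    ∃[ v ] v ∈ vertices T × Opposite T v x
  colour⇒opposite-vertex T (here refl) =
    c T , there (there (here refl)) , opposite T (c T) (a T) (b T) refl
  colour⇒opposite-vertex T (there (here refl)) =
    a T , here refl , opposite T (a T) (b T) (c T) (rotate (toℕ (a T)) _ _)
  colour⇒opposite-vertex T (there (there (here refl))) =
    b T , there (here refl) , opposite T (b T) (a T) (c T) (exchange (toℕ (a T)) _ _)

  palette-sum : ∀ T → sum (map toℕ (palette colouring T)) % m ≡ (σ T + σ T) % m
  palette-sum T = begin
    sum (map toℕ (palette colouring T)) % m            ≡⟨ cong (λ xs → sum xs % m) toℕ-palette ⟩
    sum (map (_% m) (A + B ∷ B + C ∷ A + C ∷ [])) % m  ≡⟨ sum-map-% (A + B ∷ B + C ∷ A + C ∷ []) ⟩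
    (A + B + (B + C + (A + C + 0))) % m                ≡⟨ cong (_% m) (double A B C) ⟩
    (σ T + σ T) % m                                    ∎
    where
    A = toℕ (a T)
    B = toℕ (b T)
    C = toℕ (c T)
    toℕ-palette : map toℕ (palette colouring T) ≡ map (_% m) (A + B ∷ B + C ∷ A + C ∷ [])
    toℕ-palette = cong₂ _∷_ (toℕ-colour (a T) (b T))
                 (cong₂ _∷_ (toℕ-colour (b T) (c T))
                 (cong₂ _∷_ (toℕ-colour (a T) (c T)) refl))
    double : ∀ x y z → x + y + (y + z + (x + z + 0)) ≡ x + y + z + (x + y + z)
    double = solve-∀

  σ-determined-by-palette : m % 2 ≡ 1 → ∀ {T₁ T₂} → SamePalette colouring T₁ T₂ →
    σ T₁ % m ≡ σ T₂ % m
  σ-determined-by-palette odd {T₁} {T₂} same = [m+m]%d≡[n+n]%d⇒m%d≡n%d odd (begin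
    (σ T₁ + σ T₁) % m                          ≡⟨ palette-sum T₁ ⟨
    sum (map toℕ (palette colouring T₁)) % m   ≡⟨ cong (_% m) (sum-↭ (map⁺ toℕ palette₁↭palette₂)) ⟩
    sum (map toℕ (palette colouring T₂)) % m   ≡⟨ palette-sum T₂ ⟩
    (σ T₂ + σ T₂) % m                          ∎)
    where
    palette₁↭palette₂ : palette colouring T₁ ↭ palette colouring T₂
    palette₁↭palette₂ = SamePalette⇒palette-↭ colouring proper {T₁} {T₂} same

  SamePalette⇒vertices-⊆ : m % 2 ≡ 1 → ∀ {T₁ T₂} → SamePalette colouring T₁ T₂ →
    ∀ {v} → v ∈ vertices T₁ → v ∈ vertices T₂
  SamePalette⇒vertices-⊆ odd {T₁} {T₂} same {v} v∈T₁
    with x , x∈T₁ , opp₁ ← vertex⇒opposite-colour T₁ v∈T₁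
    with w , w∈T₂ , opp₂ ← colour⇒opposite-vertex T₂
                              (SamePalette⇒palette-⊆ colouring {T₁} {T₂} same x∈T₁)
    = subst (_∈ vertices T₂) (≡-sym v≡w) w∈T₂
    where
    v≡w : v ≡ w
    v≡w = [x+v]%m-injective (toℕ x)
      (trans opp₁ (trans (σ-determined-by-palette odd {T₁} {T₂} same) (≡-sym opp₂)))

  distinguishes : m % 2 ≡ 1 → DistinguishesTriangles colouring
  distinguishes odd T₁ T₂ T₁≉T₂ same = T₁≉T₂ (same-vertices⇒SameTriangle {T₁ = T₁} {T₂}
    (SamePalette⇒vertices-⊆ odd {T₁} {T₂} same)
    (SamePalette⇒vertices-⊆ odd {T₂} {T₁} (SamePalette-sym colouring {T₁} {T₂} same)))

odd⇒τ′≤ : ∀ {n} (G : Graph n) {m} → n ≤ m → m % 2 ≡ 1 → τ′≤ G m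
odd⇒τ′≤ G {zero}    _   ()
odd⇒τ′≤ G {suc m-1} n≤m odd = colouring , proper , distinguishes odd
  where open SumColouring G (suc m-1) n≤m

n%2≡0⇒[n+1]%2≡1 : ∀ n → n % 2 ≡ 0 → (n + 1) % 2 ≡ 1
n%2≡0⇒[n+1]%2≡1 n even = trans (%-distribˡ-+ n 1 2) (cong (λ r → (r + 1) % 2) even)

mainTheorem2 : ∀ (n : ℕ) (G : Graph n) → 4 ≤ n → Connected G →
    (n % 2 ≡ 1 → τ′≤ G n) × (n % 2 ≡ 0 → τ′≤ G (n + 1))
mainTheorem2 n G _ _ =
  odd⇒τ′≤ G ≤-refl , λ even → odd⇒τ′≤ G (m≤m+n n 1) (n%2≡0⇒[n+1]%2≡1 n even)
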